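{- Let $G$ be a finite group and let $K\subseteq K'$ be an extension of strict valued $G$-fields, with fields of constants $C=K^G$ and $C'=K'^G$ respectively. Then $K$ is existentially closed in $K'$ as a valued $G$-field if and only if $C$ is existentially closed in $C'$ as a valued field.
   Context: A valued $G$-field is a valued field $(K,v)$ with an action of $G$ by field automorphisms preserving the valuation ring $\mathcal{O}_K$; it is strict if the action is faithful; its field of constants is the fixed field. Valued $G$-fields are structures in the language $\mathcal{L}^G_{\mathcal{O}}$ consisting of the ring language $\{+,-,\cdot,0,1\}$, unary function symbols $\sigma_g$ ($g\in G$) for the action, and a unary predicate $\mathcal{O}$ for the valuation ring; valued fields are structures in the language $\mathcal{L}_{\mathcal{O}}$ = ring language plus the predicate $\mathcal{O}$. "$K$ existentially closed in $K'$" means every existential sentence with parameters from $K$ true in $K'$ is true in $K$, in the respective language. -}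

module Defs where

open import Level using (0ℓ)
open import Data.Nat using (ℕ)
open import Data.Fin using (Fin)
open import Data.Empty using (⊥)
open import Data.Product using (Σ; ∃; _×_; _,_; proj₁; proj₂)
open import Data.Sum using (_⊎_)
open import Relation.Nullary using (¬_)
open import Relation.Binary.PropositionalEquality
  using (_≡_; _≢_; refl; sym; trans; cong; cong₂)
open import Algebra.Bundles using (Group)
open import Algebra.Structures using (IsCommutativeRing)
open import Function.Bundles using (_⇔_)

record ValuedField : Set₁ where
  infixl 7 _*_
  infixl 6 _+_
  field
    Carrier : Set
    0# 1#   : Carrier
    _+_ _*_ : Carrier → Carrier → Carrier
    -_      : Carrier → Carrier
    isCommutativeRing : IsCommutativeRing _≡_ _+_ _*_ -_ 0# 1#
    0≢1     : 0# ≢ 1#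
    inverse : ∀ x → x ≢ 0# → ∃ λ y → x * y ≡ 1#
    O       : Carrier → Set
    O-0     : O 0#
    O-1     : O 1#
    O-+     : ∀ {x y} → O x → O y → O (x + y)
    O--     : ∀ {x} → O x → O (- x)
    O-*     : ∀ {x y} → O x → O y → O (x * y)
    O-val   : ∀ x y → x * y ≡ 1# → O x ⊎ O y

record ValuedGField (G : Group 0ℓ 0ℓ) : Set₁ where
  module G = Group G
  field
    vf : ValuedField
  open ValuedField vf public
  field
    σ      : G.Carrier → Carrier → Carrier
    σ-cong : ∀ {g h} x → g G.≈ h → σ g x ≡ σ h x
    σ-ε    : ∀ x → σ G.ε x ≡ x
    σ-∙    : ∀ g h x → σ (g G.∙ h) x ≡ σ g (σ h x)
    σ-0    : ∀ g → σ g 0# ≡ 0#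
    σ-1    : ∀ g → σ g 1# ≡ 1#
    σ-+    : ∀ g x y → σ g (x + y) ≡ σ g x + σ g y
    σ--    : ∀ g x → σ g (- x) ≡ - σ g x
    σ-*    : ∀ g x y → σ g (x * y) ≡ σ g x * σ g y
    σ-O    : ∀ g x → O x → O (σ g x)
    σ-O⁻   : ∀ g x → O (σ g x) → O x

Strict : ∀ {G} → ValuedGField G → Set
Strict {G} K = ∀ g → (∀ x → σ g x ≡ x) → g ≈ ε
  where open ValuedGField K; open Group G using (_≈_; ε)

FiniteGroup : Group 0ℓ 0ℓ → Set
FiniteGroup G = Σ ℕ λ n → Σ (Fin n → Carrier) λ f → ∀ g → ∃ λ i → f i ≈ g
  where open Group G

-- extension K ⊆ K' of valued G-fields: embedding of L^G_O-structures
record Extension {G : Group 0ℓ 0ℓ} (K K' : ValuedGField G) : Set where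
  private
    module K  = ValuedGField K
    module K' = ValuedGField K'
  field
    ι    : K.Carrier → K'.Carrier
    ι-0  : ι K.0# ≡ K'.0#
    ι-1  : ι K.1# ≡ K'.1#
    ι-+  : ∀ x y → ι (x K.+ y) ≡ ι x K'.+ ι y
    ι--  : ∀ x → ι (K.- x) ≡ K'.- ι x
    ι-*  : ∀ x y → ι (x K.* y) ≡ ι x K'.* ι y
    ι-σ  : ∀ g x → ι (K.σ g x) ≡ K'.σ g (ι x)
    ι-O  : ∀ x → K.O x → K'.O (ι x)
    ι-O⁻ : ∀ x → K'.O (ι x) → K.O x

-- Structures for the languages L_O (F = ⊥) and L^G_O (F = G):
-- ring language, unary function symbols indexed by F, predicate O.

record Structure (F : Set) : Set₁ where
  field
    Carrier : Set
    _≈_     : Carrier → Carrier → Set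
    0# 1#   : Carrier
    _+_ _*_ : Carrier → Carrier → Carrier
    -_      : Carrier → Carrier
    fun     : F → Carrier → Carrier
    O       : Carrier → Set

data Term (A F : Set) (n : ℕ) : Set where
  var  : Fin n → Term A F n
  par  : A → Term A F n
  zer  : Term A F n
  one  : Term A F n
  add  : Term A F n → Term A F n → Term A F n
  mul  : Term A F n → Term A F n → Term A F n
  neg  : Term A F n → Term A F n
  app  : F → Term A F n → Term A F n

data QF (A F : Set) (n : ℕ) : Set where
  eq   : Term A F n → Term A F n → QF A F n
  pred : Term A F n → QF A F n
  not  : QF A F n → QF A F n
  and  : QF A F n → QF A F n → QF A F n
  or   : QF A F n → QF A F n → QF A F n

module _ {A F : Set} (S : Structure F) (p : A → Structure.Carrier S) where
  open Structure S

  eval : ∀ {n} → (Fin n → Carrier) → Term A F n → Carrier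
  eval v (var i)   = v i
  eval v (par a)   = p a
  eval v zer       = 0#
  eval v one       = 1#
  eval v (add s t) = eval v s + eval v t
  eval v (mul s t) = eval v s * eval v t
  eval v (neg t)   = - eval v t
  eval v (app f t) = fun f (eval v t)

  Sat : ∀ {n} → (Fin n → Carrier) → QF A F n → Set
  Sat v (eq s t)  = eval v s ≈ eval v t
  Sat v (pred t)  = O (eval v t)
  Sat v (not φ)   = ¬ Sat v φ
  Sat v (and φ ψ) = Sat v φ × Sat v ψ
  Sat v (or φ ψ)  = Sat v φ ⊎ Sat v ψ

ExistentiallyClosed : ∀ {F} (S T : Structure F) →
  (Structure.Carrier S → Structure.Carrier T) → Set
ExistentiallyClosed S T ι =
  ∀ n (φ : QF (Structure.Carrier S) _ n) →
    (Σ (Fin n → Structure.Carrier T) λ v → Sat T ι v φ) →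
    (Σ (Fin n → Structure.Carrier S) λ v → Sat S (λ a → a) v φ)

GStructure : ∀ {G} → ValuedGField G → Structure (Group.Carrier G)
GStructure K = record
  { Carrier = Carrier ; _≈_ = _≡_ ; 0# = 0# ; 1# = 1#
  ; _+_ = _+_ ; _*_ = _*_ ; -_ = -_ ; fun = σ ; O = O }
  where open ValuedGField K

module _ {G : Group 0ℓ 0ℓ} (K : ValuedGField G) where
  open ValuedGField K

  Fixed : Carrier → Set
  Fixed x = ∀ g → σ g x ≡ x

  ConstCarrier : Set
  ConstCarrier = Σ Carrier Fixed

  ConstStructure : Structure ⊥
  ConstStructure = record
    { Carrier = ConstCarrier
    ; _≈_ = λ a b → proj₁ a ≡ proj₁ b
    ; 0# = 0# , σ-0
    ; 1# = 1# , σ-1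
    ; _+_ = λ a b → proj₁ a + proj₁ b ,
        λ g → trans (σ-+ g _ _) (cong₂ _+_ (proj₂ a g) (proj₂ b g))
    ; _*_ = λ a b → proj₁ a * proj₁ b ,
        λ g → trans (σ-* g _ _) (cong₂ _*_ (proj₂ a g) (proj₂ b g))
    ; -_ = λ a → - proj₁ a , λ g → trans (σ-- g _) (cong -_ (proj₂ a g))
    ; fun = λ ()
    ; O = λ a → O (proj₁ a)
    }

constEmb : ∀ {G} {K K' : ValuedGField G} → Extension K K' →
  ConstCarrier K → ConstCarrier K'
constEmb {K' = K'} E (x , fx) =
  ι x , λ g → trans (sym (ι-σ g x)) (cong ι (fx g))
  where open Extension E

-- Since G is finite and acts faithfully, Artin's argument gives d₁ … dₘ, b₁ … bₘ ∈ K with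
-- Σᵢ dᵢ σ_g(bᵢ) = 1 for g = ε and 0 otherwise; hence every y in K (and, via the embedding, in K′)
-- is Σᵢ dᵢ Tr(bᵢ y) with coordinates Tr(bᵢ y) in the constants. Replacing each variable x by
-- Σᵢ dᵢ xᵢ with constant unknowns xᵢ turns a quantifier-free L^G_O-formula into an L_O-formula
-- over the constants: equations are compared coordinatewise, σ_g only moves the dᵢ, and y ∈ O is
-- replaced by Nm y ∈ O, which is equivalent because O is a G-invariant valuation ring. Solutions
-- correspond in K and K′ alike, so existential closedness transfers from C to K. Conversely a
-- formula over C is a formula over K whose variables are also required to be fixed by G.

module Submission where

open import Defs
open import Level using (0ℓ)
open import Algebra.Bundles using (Group; CommutativeMonoid; CommutativeRing)
open import Axiom.ExcludedMiddle using (ExcludedMiddle)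
open import Data.Empty using (⊥; ⊥-elim)
open import Data.Fin using (Fin; zero; suc; combine; remQuot)
open import Data.Fin.Properties using (suc-injective; remQuot-combine)
open import Data.Fin.Permutation using (Permutation; permutation)
open import Data.List using (List; []; _∷_; _++_; map; length; lookup)
open import Data.Nat as ℕ using (ℕ; zero; suc)
open import Data.Product using (Σ; ∃; _×_; _,_; proj₁; proj₂)
open import Data.Sum using (inj₁; inj₂)
open import Function.Base using (_∘_)
open import Function.Bundles using (_⇔_; mk⇔)
open import Relation.Nullary using (¬_; yes; no)
open import Relation.Binary.PropositionalEquality
  using (_≡_; _≢_; refl; sym; trans; cong; cong₂; subst; module ≡-Reasoning)
import Algebra.Properties.CommutativeMonoid.Sum as CommutativeMonoidSum
import Algebra.Properties.Ring as RingProperties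
import Algebra.Properties.Semiring.Sum as SemiringSum
import Algebra.Solver.Ring.NaturalCoefficients.Default as NaturalSolver

module ValuedFieldProperties (F : ValuedField) where
  open ValuedField F public

  commutativeRing : CommutativeRing 0ℓ 0ℓ
  commutativeRing = record
    { Carrier = Carrier ; _≈_ = _≡_ ; _+_ = _+_ ; _*_ = _*_ ; -_ = -_
    ; 0# = 0# ; 1# = 1# ; isCommutativeRing = isCommutativeRing }

  open CommutativeRing commutativeRing public
    using ( +-assoc; *-assoc; *-comm; distribˡ; distribʳ; +-identityˡ; +-identityʳ
          ; *-identityˡ; *-identityʳ; zeroˡ; zeroʳ; -‿inverseʳ )
  open CommutativeRing commutativeRing using (ring; semiring; *-commutativeMonoid; commutativeSemiring)
  open RingProperties ring public using (-‿distribˡ-*; -‿distribʳ-*; -1*x≈-x; x∙y⁻¹≈ε⇒x≈y)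
  open SemiringSum semiring public
    using (sum; sum-cong-≗; sum-replicate-zero; ∑-distrib-+; *-distribˡ-sum; *-distribʳ-sum; ∑-comm)
  open CommutativeMonoidSum *-commutativeMonoid public
    using () renaming (sum to prod; sum-cong-≗ to prod-cong-≗; ∑-distrib-+ to ∏-distrib-*;
                       sum-replicate-zero to prod-replicate-one)
  open NaturalSolver commutativeSemiring public using (solve; _:=_; _:+_; _:*_)

  -‿distrib-sum : ∀ {n} (f : Fin n → Carrier) → - sum f ≡ sum (λ i → - f i)
  -‿distrib-sum f = begin
    - sum f                    ≡⟨ -1*x≈-x (sum f) ⟨
    - 1# * sum f               ≡⟨ *-distribˡ-sum (- 1#) f ⟩
    sum (λ i → - 1# * f i)     ≡⟨ sum-cong-≗ (λ i → -1*x≈-x (f i)) ⟩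
    sum (λ i → - f i)          ∎
    where open ≡-Reasoning

  sum-single : ∀ {n} (f : Fin n → Carrier) (l₀ : Fin n) →
    (∀ l → l ≢ l₀ → f l ≡ 0#) → sum f ≡ f l₀
  sum-single {suc n} f zero f≡0 =
    trans (cong (f zero +_) (trans (sum-cong-≗ (λ i → f≡0 (suc i) (λ ()))) (sum-replicate-zero n)))
          (+-identityʳ _)
  sum-single {suc n} f (suc l₀) f≡0 =
    trans (cong (_+ sum (λ i → f (suc i))) (f≡0 zero (λ ())))
          (trans (+-identityˡ _) (sum-single (λ i → f (suc i)) l₀ (λ l l≢l₀ → f≡0 (suc l) (l≢l₀ ∘ suc-injective))))

  ∑-comm-factorˡ : ∀ {r m} (a : Fin m → Carrier) (Y : Fin r → Fin m → Carrier) →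
    sum (λ i → sum (λ k → a k * Y i k)) ≡ sum (λ k → a k * sum (λ i → Y i k))
  ∑-comm-factorˡ a Y =
    trans (∑-comm (λ i k → a k * Y i k)) (sum-cong-≗ (λ k → sym (*-distribˡ-sum (a k) (λ i → Y i k))))

  O-prod : ∀ {n} (f : Fin n → Carrier) → (∀ i → O (f i)) → O (prod f)
  O-prod {zero} f Of = O-1
  O-prod {suc n} f Of = O-* (Of zero) (O-prod (λ i → f (suc i)) (λ i → Of (suc i)))

  prod-split-O : ∀ {n} (f : Fin n → Carrier) (l₀ : Fin n) → (∀ l → l ≢ l₀ → O (f l)) →
    ∃ λ P → O P × prod f ≡ f l₀ * P
  prod-split-O {suc n} f zero Of = prod (λ i → f (suc i)) , O-prod _ (λ i → Of (suc i) (λ ())) , refl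
  prod-split-O {suc n} f (suc l₀) Of
    with prod-split-O (λ i → f (suc i)) l₀ (λ l l≢l₀ → Of (suc l) (λ p → l≢l₀ (suc-injective p)))
  ... | P , OP , prod≡ =
    f zero * P , O-* (Of zero (λ ())) OP ,
    trans (cong (f zero *_) prod≡) (solve 3 (λ a b c → a :* (b :* c) := b :* (a :* c)) refl _ _ _)

  inverse-unique : ∀ x y z → x * y ≡ 1# → x * z ≡ 1# → y ≡ z
  inverse-unique x y z xy≡1 xz≡1 = begin
    y            ≡⟨ *-identityˡ y ⟨
    1# * y       ≡⟨ cong (_* y) xz≡1 ⟨
    (x * z) * y  ≡⟨ solve 3 (λ x y z → (x :* z) :* y := (x :* y) :* z) refl x y z ⟩
    (x * y) * z  ≡⟨ cong (_* z) xy≡1 ⟩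
    1# * z       ≡⟨ *-identityˡ z ⟩
    z            ∎
    where open ≡-Reasoning

record Enumeration (G : Group 0ℓ 0ℓ) : Set where
  open Group G
    using (Carrier; _≈_; _∙_; _⁻¹; ε; ∙-congˡ; ∙-congʳ; assoc; identityˡ; inverseˡ; inverseʳ; setoid)
  field
    order            : ℕ
    elem             : Fin order → Carrier
    elem-surjective  : ∀ g → ∃ λ l → elem l ≈ g
    elem-injective   : ∀ {l l′} → elem l ≈ elem l′ → l ≡ l′

  index : Carrier → Fin order
  index g = proj₁ (elem-surjective g)

  elem-index : ∀ g → elem (index g) ≈ g
  elem-index g = proj₂ (elem-surjective g)

  translation : Carrier → Permutation order order
  translation h = permutation (λ l → index (h ∙ elem l)) (λ l → index (h ⁻¹ ∙ elem l))
    (λ l → elem-injective (cancel h (h ⁻¹) (elem l) (inverseʳ h)))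
    (λ l → elem-injective (cancel (h ⁻¹) h (elem l) (inverseˡ h)))
    where
      cancel : ∀ h h′ x → h ∙ h′ ≈ ε → elem (index (h ∙ elem (index (h′ ∙ x)))) ≈ x
      cancel h h′ x hh′≈ε = begin
        elem (index (h ∙ elem (index (h′ ∙ x))))  ≈⟨ elem-index _ ⟩
        h ∙ elem (index (h′ ∙ x))                 ≈⟨ ∙-congˡ (elem-index _) ⟩
        h ∙ (h′ ∙ x)                              ≈⟨ assoc h h′ x ⟨
        (h ∙ h′) ∙ x                              ≈⟨ ∙-congʳ hh′≈ε ⟩
        ε ∙ x                                     ≈⟨ identityˡ x ⟩
        x                                         ∎
        where open import Relation.Binary.Reasoning.Setoid setoid

module _ {c ℓ} {G : Group 0ℓ 0ℓ} (en : Enumeration G) (M : CommutativeMonoid c ℓ) where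
  open Group G using (_∙_) renaming (Carrier to Elem; _≈_ to _≈ᴳ_)
  module M = CommutativeMonoid M
  open CommutativeMonoid M using (Carrier; _≈_)
  open CommutativeMonoidSum M using (sum; sum-permute; sum-cong-≋)
  open Enumeration en

  sum-translate : ∀ h (F : Elem → Carrier) → (∀ {g g′} → g ≈ᴳ g′ → F g ≈ F g′) →
    sum (λ l → F (h ∙ elem l)) ≈ sum (λ l → F (elem l))
  sum-translate h F F-cong =
    M.sym (M.trans (sum-permute (λ l → F (elem l)) (translation h))
               (sum-cong-≋ (λ l → F-cong (elem-index (h ∙ elem l)))))

module _ (em : ExcludedMiddle 0ℓ) (G : Group 0ℓ 0ℓ) where
  open Group G using (Carrier; _≈_) renaming (refl to ≈-refl; sym to ≈-sym; trans to ≈-trans)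

  record Deduplication {m} (f : Fin m → Carrier) : Set where
    field
      size          : ℕ
      entry         : Fin size → Carrier
      entry-covers  : ∀ i → ∃ λ l → entry l ≈ f i
      entry-injective : ∀ {l l′} → entry l ≈ entry l′ → l ≡ l′

  deduplicate : ∀ {m} (f : Fin m → Carrier) → Deduplication f
  deduplicate {zero} f = record
    { size = 0 ; entry = λ () ; entry-covers = λ () ; entry-injective = λ { {()} } }
  deduplicate {suc m} f with deduplicate (λ i → f (suc i))
  ... | D with em {∃ λ l → Deduplication.entry D l ≈ f zero}
  ... | yes (l , p) = record { Deduplication D ; entry-covers = covers }
    where
      open Deduplication D
      covers : ∀ i → ∃ λ l → entry l ≈ f i
      covers zero    = l , p
      covers (suc i) = entry-covers i
  ... | no ¬p = record
    { size = suc size ; entry = entry′ ; entry-covers = covers ; entry-injective = injective }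
    where
      open Deduplication D
      entry′ : Fin (suc size) → Carrier
      entry′ zero    = f zero
      entry′ (suc l) = entry l
      covers : ∀ i → ∃ λ l → entry′ l ≈ f i
      covers zero    = zero , ≈-refl
      covers (suc i) = suc (proj₁ (entry-covers i)) , proj₂ (entry-covers i)
      injective : ∀ {l l′} → entry′ l ≈ entry′ l′ → l ≡ l′
      injective {zero}  {zero}   _ = refl
      injective {zero}  {suc l′} q = ⊥-elim (¬p (l′ , ≈-sym q))
      injective {suc l} {zero}   q = ⊥-elim (¬p (l , q))
      injective {suc l} {suc l′} q = cong suc (entry-injective q)

  enumerate : FiniteGroup G → Enumeration G
  enumerate (m , f , f-surjective) = record
    { order = size ; elem = entry ; elem-surjective = surjective ; elem-injective = entry-injective }
    where
      open Deduplication (deduplicate f)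
      surjective : ∀ g → ∃ λ l → entry l ≈ g
      surjective g with f-surjective g
      ... | i , fi≈g = proj₁ (entry-covers i) , ≈-trans (proj₂ (entry-covers i)) fi≈g

module TraceNorm {G : Group 0ℓ 0ℓ} (K : ValuedGField G) (en : Enumeration G) where
  open ValuedGField K public using (σ)
  open ValuedGField K using (σ-cong; σ-ε; σ-∙; σ-0; σ-1; σ-+; σ-*; σ-O; vf)
  open ValuedFieldProperties vf public
  open Enumeration en public
  open Group G using (_∙_; ε) renaming (_≈_ to _≈ᴳ_; sym to ≈ᴳ-sym; trans to ≈ᴳ-trans)
  open CommutativeRing commutativeRing using (+-commutativeMonoid; *-commutativeMonoid)
  open ≡-Reasoning

  Tr : Carrier → Carrier
  Tr y = sum (λ l → σ (elem l) y)

  Nm : Carrier → Carrier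
  Nm y = prod (λ l → σ (elem l) y)

  σ-sum : ∀ {r} g (f : Fin r → Carrier) → σ g (sum f) ≡ sum (λ i → σ g (f i))
  σ-sum {zero}  g f = σ-0 g
  σ-sum {suc r} g f = trans (σ-+ g _ _) (cong (σ g (f zero) +_) (σ-sum g (λ i → f (suc i))))

  σ-prod : ∀ {r} g (f : Fin r → Carrier) → σ g (prod f) ≡ prod (λ i → σ g (f i))
  σ-prod {zero}  g f = σ-1 g
  σ-prod {suc r} g f = trans (σ-* g _ _) (cong (σ g (f zero) *_) (σ-prod g (λ i → f (suc i))))

  σ-elem-index-ε : ∀ y → σ (elem (index ε)) y ≡ y
  σ-elem-index-ε y = trans (σ-cong y (elem-index ε)) (σ-ε y)

  Tr-fixed : ∀ y → Fixed K (Tr y)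
  Tr-fixed y h = begin
    σ h (Tr y)                      ≡⟨ σ-sum h (λ l → σ (elem l) y) ⟩
    sum (λ l → σ h (σ (elem l) y))  ≡⟨ sum-cong-≗ (λ l → σ-∙ h (elem l) y) ⟨
    sum (λ l → σ (h ∙ elem l) y)    ≡⟨ sum-translate en +-commutativeMonoid h (λ g → σ g y) (σ-cong y) ⟩
    Tr y                            ∎

  Nm-fixed : ∀ y → Fixed K (Nm y)
  Nm-fixed y h = begin
    σ h (Nm y)                       ≡⟨ σ-prod h (λ l → σ (elem l) y) ⟩
    prod (λ l → σ h (σ (elem l) y))  ≡⟨ prod-cong-≗ (λ l → σ-∙ h (elem l) y) ⟨
    prod (λ l → σ (h ∙ elem l) y)    ≡⟨ sum-translate en *-commutativeMonoid h (λ g → σ g y) (σ-cong y) ⟩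
    Nm y                             ∎

  Tr-sum : ∀ {r} (f : Fin r → Carrier) → Tr (sum f) ≡ sum (λ i → Tr (f i))
  Tr-sum f = trans (sum-cong-≗ (λ l → σ-sum (elem l) f)) (∑-comm (λ l i → σ (elem l) (f i)))

  Tr-*ˡ-fixed : ∀ c → Fixed K c → ∀ y → Tr (c * y) ≡ c * Tr y
  Tr-*ˡ-fixed c c-fixed y = begin
    sum (λ l → σ (elem l) (c * y))  ≡⟨ sum-cong-≗ (λ l → trans (σ-* (elem l) c y) (cong (_* σ (elem l) y) (c-fixed (elem l)))) ⟩
    sum (λ l → c * σ (elem l) y)    ≡⟨ *-distribˡ-sum c (λ l → σ (elem l) y) ⟨
    c * Tr y                        ∎

  Nm-* : ∀ x y → Nm (x * y) ≡ Nm x * Nm y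
  Nm-* x y = trans (prod-cong-≗ (λ l → σ-* (elem l) x y)) (∏-distrib-* (λ l → σ (elem l) x) (λ l → σ (elem l) y))

  Nm-1 : Nm 1# ≡ 1#
  Nm-1 = trans (prod-cong-≗ (λ l → σ-1 (elem l))) (prod-replicate-one order)

  O⇒O-Nm : ∀ y → O y → O (Nm y)
  O⇒O-Nm y Oy = O-prod _ (λ l → σ-O (elem l) y Oy)

  -- If y ∉ O then z = y⁻¹ ∈ O, and y = Nm y · ∏_{g ≠ ε} σ_g(z) would lie in O.
  O-Nm⇒O : ExcludedMiddle 0ℓ → ∀ y → O (Nm y) → O y
  O-Nm⇒O em y O-Nm-y with em {O y}
  ... | yes Oy = Oy
  ... | no ¬Oy = ⊥-elim (¬Oy (subst O (sym y≡Nm-y*P) (O-* O-Nm-y OP)))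
    where
      y≢0 : y ≢ 0#
      y≢0 y≡0 = ¬Oy (subst O (sym y≡0) O-0)
      z : Carrier
      z = proj₁ (inverse y y≢0)
      yz≡1 : y * z ≡ 1#
      yz≡1 = proj₂ (inverse y y≢0)
      Oz : O z
      Oz with O-val y z yz≡1
      ... | inj₁ Oy = ⊥-elim (¬Oy Oy)
      ... | inj₂ Oz = Oz
      split : ∃ λ P → O P × Nm z ≡ σ (elem (index ε)) z * P
      split = prod-split-O (λ l → σ (elem l) z) (index ε) (λ l _ → σ-O (elem l) z Oz)
      P : Carrier
      P = proj₁ split
      OP : O P
      OP = proj₁ (proj₂ split)
      Nm-z : Nm z ≡ z * P
      Nm-z = trans (proj₂ (proj₂ split)) (cong (_* P) (σ-elem-index-ε z))
      y≡Nm-y*P : y ≡ Nm y * P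
      y≡Nm-y*P = begin
        y                     ≡⟨ *-identityʳ y ⟨
        y * 1#                ≡⟨ cong (y *_) Nm-1 ⟨
        y * Nm 1#             ≡⟨ cong (λ w → y * Nm w) yz≡1 ⟨
        y * Nm (y * z)        ≡⟨ cong (y *_) (trans (Nm-* y z) (cong (Nm y *_) Nm-z)) ⟩
        y * (Nm y * (z * P))  ≡⟨ solve 4 (λ a b c d → a :* (b :* (c :* d)) := b :* ((a :* c) :* d)) refl y (Nm y) z P ⟩
        Nm y * ((y * z) * P)  ≡⟨ cong (λ w → Nm y * (w * P)) yz≡1 ⟩
        Nm y * (1# * P)       ≡⟨ cong (Nm y *_) (*-identityˡ P) ⟩
        Nm y * P              ∎

  -- The role of a dual basis: y ↦ (Tr (bᵢ y))ᵢ are coordinates of K over its constants.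
  record DualBasis : Set where
    field
      size   : ℕ
      d b    : Fin size → Carrier
      dual-ε : ∀ g → g ≈ᴳ ε → sum (λ i → d i * σ g (b i)) ≡ 1#
      dual-≉ : ∀ g → ¬ g ≈ᴳ ε → sum (λ i → d i * σ g (b i)) ≡ 0#

    expansion : ∀ y → y ≡ sum (λ k → d k * Tr (b k * y))
    expansion y = sym (begin
      sum (λ k → d k * Tr (b k * y))
        ≡⟨ sum-cong-≗ (λ k → *-distribˡ-sum (d k) (λ l → σ (elem l) (b k * y))) ⟩
      sum (λ k → sum (λ l → d k * σ (elem l) (b k * y)))
        ≡⟨ ∑-comm (λ k l → d k * σ (elem l) (b k * y)) ⟩
      sum (λ l → sum (λ k → d k * σ (elem l) (b k * y)))
        ≡⟨ sum-cong-≗ (λ l → trans (sum-cong-≗ (λ k → trans (cong (d k *_) (σ-* (elem l) (b k) y)) (sym (*-assoc _ _ _))))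
                                   (sym (*-distribʳ-sum (σ (elem l) y) (λ k → d k * σ (elem l) (b k))))) ⟩
      sum (λ l → sum (λ k → d k * σ (elem l) (b k)) * σ (elem l) y)
        ≡⟨ sum-single _ (index ε) (λ l l≢ → trans (cong (_* σ (elem l) y) (dual-≉ (elem l) (λ l≈ε → l≢ (elem-injective (≈ᴳ-trans l≈ε (≈ᴳ-sym (elem-index ε))))))) (zeroˡ _)) ⟩
      sum (λ k → d k * σ (elem (index ε)) (b k)) * σ (elem (index ε)) y
        ≡⟨ cong₂ _*_ (dual-ε _ (elem-index ε)) (σ-elem-index-ε y) ⟩
      1# * y
        ≡⟨ *-identityˡ y ⟩
      y ∎)

    Tr-coordinates-injective : ∀ x y → (∀ k → Tr (b k * x) ≡ Tr (b k * y)) → x ≡ y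
    Tr-coordinates-injective x y same = begin
      x                               ≡⟨ expansion x ⟩
      sum (λ k → d k * Tr (b k * x))  ≡⟨ sum-cong-≗ (λ k → cong (d k *_) (same k)) ⟩
      sum (λ k → d k * Tr (b k * y))  ≡⟨ expansion y ⟨
      y                               ∎

    Tr-*-combination : ∀ k (c : Fin size → Carrier) → (∀ i → Fixed K (c i)) →
      Tr (b k * sum (λ i → d i * c i)) ≡ sum (λ i → Tr (b k * d i) * c i)
    Tr-*-combination k c c-fixed = begin
      Tr (b k * sum (λ i → d i * c i))     ≡⟨ cong Tr (*-distribˡ-sum (b k) (λ i → d i * c i)) ⟩
      Tr (sum (λ i → b k * (d i * c i)))   ≡⟨ Tr-sum (λ i → b k * (d i * c i)) ⟩
      sum (λ i → Tr (b k * (d i * c i)))   ≡⟨ sum-cong-≗ (λ i → trans (cong Tr (rearrange (b k) (d i) (c i)))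
                                                                   (trans (Tr-*ˡ-fixed (c i) (c-fixed i) _) (*-comm _ _))) ⟩
      sum (λ i → Tr (b k * d i) * c i)     ∎
      where
        rearrange : ∀ x y z → x * (y * z) ≡ z * (x * y)
        rearrange = solve 3 (λ x y z → x :* (y :* z) := z :* (x :* y)) refl

module DualBasisConstruction (em : ExcludedMiddle 0ℓ) {G : Group 0ℓ 0ℓ} (K : ValuedGField G)
                             (strict : Strict K) (en : Enumeration G) where
  open ValuedGField K using (σ-cong; σ-ε; σ-1; σ-*)
  open TraceNorm K en
  open Group G using (ε) renaming (Carrier to Elem; _≈_ to _≈ᴳ_; sym to ≈ᴳ-sym; trans to ≈ᴳ-trans)
  open ≡-Reasoning

  -- A list of pairs (x , y) stands for the function g ↦ Σ x σ_g(y).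
  Twisted : Set
  Twisted = List (Carrier × Carrier)

  ⟦_⟧ : Twisted → Elem → Carrier
  ⟦ [] ⟧          g = 0#
  ⟦ (x , y) ∷ w ⟧ g = x * σ g y + ⟦ w ⟧ g

  ⟦⟧-++ : ∀ w w′ g → ⟦ w ++ w′ ⟧ g ≡ ⟦ w ⟧ g + ⟦ w′ ⟧ g
  ⟦⟧-++ []            w′ g = sym (+-identityˡ _)
  ⟦⟧-++ ((x , y) ∷ w) w′ g = trans (cong (x * σ g y +_) (⟦⟧-++ w w′ g)) (sym (+-assoc _ _ _))

  scale : Carrier × Carrier → Twisted → Twisted
  scale (x , y) = map (λ p → x * proj₁ p , y * proj₂ p)

  ⟦⟧-scale : ∀ x y w g → ⟦ scale (x , y) w ⟧ g ≡ (x * σ g y) * ⟦ w ⟧ g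
  ⟦⟧-scale x y []              g = sym (zeroʳ _)
  ⟦⟧-scale x y ((x′ , y′) ∷ w) g = begin
    x * x′ * σ g (y * y′) + ⟦ scale (x , y) w ⟧ g
      ≡⟨ cong₂ _+_ (cong (x * x′ *_) (σ-* g y y′)) (⟦⟧-scale x y w g) ⟩
    x * x′ * (σ g y * σ g y′) + (x * σ g y) * ⟦ w ⟧ g
      ≡⟨ solve 5 (λ a b c d v → a :* b :* (c :* d) :+ (a :* c) :* v := (a :* c) :* (b :* d :+ v))
               refl x x′ (σ g y) (σ g y′) (⟦ w ⟧ g) ⟩
    (x * σ g y) * (x′ * σ g y′ + ⟦ w ⟧ g) ∎

  _⊗_ : Twisted → Twisted → Twisted
  []      ⊗ w′ = []
  (p ∷ w) ⊗ w′ = scale p w′ ++ (w ⊗ w′)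

  ⟦⟧-⊗ : ∀ w w′ g → ⟦ w ⊗ w′ ⟧ g ≡ ⟦ w ⟧ g * ⟦ w′ ⟧ g
  ⟦⟧-⊗ []            w′ g = sym (zeroˡ _)
  ⟦⟧-⊗ ((x , y) ∷ w) w′ g = begin
    ⟦ scale (x , y) w′ ++ (w ⊗ w′) ⟧ g        ≡⟨ ⟦⟧-++ (scale (x , y) w′) (w ⊗ w′) g ⟩
    ⟦ scale (x , y) w′ ⟧ g + ⟦ w ⊗ w′ ⟧ g     ≡⟨ cong₂ _+_ (⟦⟧-scale x y w′ g) (⟦⟧-⊗ w w′ g) ⟩
    (x * σ g y) * ⟦ w′ ⟧ g + ⟦ w ⟧ g * ⟦ w′ ⟧ g  ≡⟨ distribʳ _ _ _ ⟨
    (x * σ g y + ⟦ w ⟧ g) * ⟦ w′ ⟧ g          ∎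

  unit : Twisted
  unit = (1# , 1#) ∷ []

  ⟦⟧-unit : ∀ g → ⟦ unit ⟧ g ≡ 1#
  ⟦⟧-unit g = trans (+-identityʳ _) (trans (cong (1# *_) (σ-1 g)) (*-identityˡ _))

  ⟦⟧-as-sum : ∀ w g → ⟦ w ⟧ g ≡ sum (λ i → proj₁ (lookup w i) * σ g (proj₂ (lookup w i)))
  ⟦⟧-as-sum []            g = refl
  ⟦⟧-as-sum ((x , y) ∷ w) g = cong (x * σ g y +_) (⟦⟧-as-sum w g)

  moved-by : ∀ h → ¬ h ≈ᴳ ε → ∃ λ a → σ h a ≢ a
  moved-by h h≉ε with em {∃ λ a → σ h a ≢ a}
  ... | yes moved = moved
  ... | no ¬moved = ⊥-elim (h≉ε (strict h fixes-all))
    where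
      fixes-all : ∀ x → σ h x ≡ x
      fixes-all x with em {σ h x ≡ x}
      ... | yes σx≡x = σx≡x
      ... | no σx≢x  = ⊥-elim (¬moved (x , σx≢x))

  -- For a moved by h and u = (a - σ_h a)⁻¹, the function g ↦ u (σ_g a - σ_h a) is 1 at ε and 0 at h.
  module Separator (h : Elem) (h≉ε : ¬ h ≈ᴳ ε) where
    a : Carrier
    a = proj₁ (moved-by h h≉ε)

    a-σa≢0 : a + - σ h a ≢ 0#
    a-σa≢0 p = proj₂ (moved-by h h≉ε) (sym (x∙y⁻¹≈ε⇒x≈y _ _ p))

    u : Carrier
    u = proj₁ (inverse _ a-σa≢0)

    separator : Twisted
    separator = (u , a) ∷ (- (σ h a * u) , 1#) ∷ []

    ⟦⟧-separator : ∀ g → ⟦ separator ⟧ g ≡ (σ g a + - σ h a) * u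
    ⟦⟧-separator g = begin
      u * σ g a + (- (σ h a * u) * σ g 1# + 0#)  ≡⟨ cong (λ t → u * σ g a + (- (σ h a * u) * t + 0#)) (σ-1 g) ⟩
      u * σ g a + (- (σ h a * u) * 1# + 0#)      ≡⟨ cong (u * σ g a +_) (trans (+-identityʳ _) (*-identityʳ _)) ⟩
      u * σ g a + - (σ h a * u)                  ≡⟨ cong₂ _+_ (*-comm u (σ g a)) (-‿distribˡ-* (σ h a) u) ⟩
      σ g a * u + (- σ h a) * u                  ≡⟨ distribʳ u (σ g a) (- σ h a) ⟨
      (σ g a + - σ h a) * u                      ∎

    separator-ε : ∀ g → g ≈ᴳ ε → ⟦ separator ⟧ g ≡ 1#
    separator-ε g g≈ε = begin
      ⟦ separator ⟧ g          ≡⟨ ⟦⟧-separator g ⟩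
      (σ g a + - σ h a) * u    ≡⟨ cong (λ t → (t + - σ h a) * u) (trans (σ-cong a g≈ε) (σ-ε a)) ⟩
      (a + - σ h a) * u        ≡⟨ proj₂ (inverse _ a-σa≢0) ⟩
      1#                       ∎

    separator-self : ∀ g → g ≈ᴳ h → ⟦ separator ⟧ g ≡ 0#
    separator-self g g≈h = begin
      ⟦ separator ⟧ g          ≡⟨ ⟦⟧-separator g ⟩
      (σ g a + - σ h a) * u    ≡⟨ cong (λ t → (t + - σ h a) * u) (σ-cong a g≈h) ⟩
      (σ h a + - σ h a) * u    ≡⟨ cong (_* u) (-‿inverseʳ (σ h a)) ⟩
      0# * u                   ≡⟨ zeroˡ u ⟩
      0#                       ∎

  open Separator using (separator; separator-ε; separator-self)

  indicator : ∀ {r} → (Fin r → Elem) → Twisted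
  indicator {zero}  f = unit
  indicator {suc r} f with em {f zero ≈ᴳ ε}
  ... | yes _   = indicator (f ∘ suc)
  ... | no f₀≉ε = separator (f zero) f₀≉ε ⊗ indicator (f ∘ suc)

  indicator-ε : ∀ {r} (f : Fin r → Elem) g → g ≈ᴳ ε → ⟦ indicator f ⟧ g ≡ 1#
  indicator-ε {zero}  f g g≈ε = ⟦⟧-unit g
  indicator-ε {suc r} f g g≈ε with em {f zero ≈ᴳ ε}
  ... | yes _   = indicator-ε (f ∘ suc) g g≈ε
  ... | no f₀≉ε = begin
    ⟦ separator (f zero) f₀≉ε ⊗ indicator (f ∘ suc) ⟧ g        ≡⟨ ⟦⟧-⊗ (separator (f zero) f₀≉ε) (indicator (f ∘ suc)) g ⟩
    ⟦ separator (f zero) f₀≉ε ⟧ g * ⟦ indicator (f ∘ suc) ⟧ g  ≡⟨ cong₂ _*_ (separator-ε _ f₀≉ε g g≈ε) (indicator-ε (f ∘ suc) g g≈ε) ⟩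
    1# * 1#                                                     ≡⟨ *-identityˡ 1# ⟩
    1#                                                          ∎

  indicator-≉ε : ∀ {r} (f : Fin r → Elem) i g → f i ≈ᴳ g → ¬ g ≈ᴳ ε → ⟦ indicator f ⟧ g ≡ 0#
  indicator-≉ε {suc r} f i g fi≈g g≉ε with em {f zero ≈ᴳ ε}
  indicator-≉ε {suc r} f zero g fi≈g g≉ε | yes f₀≈ε = ⊥-elim (g≉ε (≈ᴳ-trans (≈ᴳ-sym fi≈g) f₀≈ε))
  indicator-≉ε {suc r} f (suc i) g fi≈g g≉ε | yes _ = indicator-≉ε (f ∘ suc) i g fi≈g g≉ε
  indicator-≉ε {suc r} f i g fi≈g g≉ε | no f₀≉ε = begin
    ⟦ separator (f zero) f₀≉ε ⊗ indicator (f ∘ suc) ⟧ g        ≡⟨ ⟦⟧-⊗ (separator (f zero) f₀≉ε) (indicator (f ∘ suc)) g ⟩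
    ⟦ separator (f zero) f₀≉ε ⟧ g * ⟦ indicator (f ∘ suc) ⟧ g  ≡⟨ vanishes i fi≈g ⟩
    0#                                                          ∎
    where
      vanishes : ∀ i → f i ≈ᴳ g → ⟦ separator (f zero) f₀≉ε ⟧ g * ⟦ indicator (f ∘ suc) ⟧ g ≡ 0#
      vanishes zero    f₀≈g = trans (cong (_* ⟦ indicator (f ∘ suc) ⟧ g) (separator-self _ f₀≉ε g (≈ᴳ-sym f₀≈g))) (zeroˡ _)
      vanishes (suc i) fi≈g = trans (cong (⟦ separator (f zero) f₀≉ε ⟧ g *_) (indicator-≉ε (f ∘ suc) i g fi≈g g≉ε)) (zeroʳ _)

  dualBasis : DualBasis
  dualBasis = record
    { size   = length δ
    ; d      = proj₁ ∘ lookup δ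
    ; b      = proj₂ ∘ lookup δ
    ; dual-ε = λ g g≈ε → trans (sym (⟦⟧-as-sum δ g)) (indicator-ε elem g g≈ε)
    ; dual-≉ = λ g g≉ε → trans (sym (⟦⟧-as-sum δ g)) (indicator-≉ε elem (index g) g (elem-index g) g≉ε)
    }
    where
      δ : Twisted
      δ = indicator elem

⊤ᶠ : ∀ {A F : Set} {N} → QF A F N
⊤ᶠ = eq zer zer

⋀ : ∀ {A F : Set} {N r} → (Fin r → QF A F N) → QF A F N
⋀ {r = zero}  φ = ⊤ᶠ
⋀ {r = suc r} φ = and (φ zero) (⋀ (φ ∘ suc))

∑ₜ : ∀ {A F : Set} {N r} → (Fin r → Term A F N) → Term A F N
∑ₜ {r = zero}  t = zer
∑ₜ {r = suc r} t = add (t zero) (∑ₜ (t ∘ suc))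

∏ₜ : ∀ {A F : Set} {N r} → (Fin r → Term A F N) → Term A F N
∏ₜ {r = zero}  t = one
∏ₜ {r = suc r} t = mul (t zero) (∏ₜ (t ∘ suc))

module _ {A F : Set} (S : Structure F) (p : A → Structure.Carrier S) {N}
         (v : Fin N → Structure.Carrier S) where

  ⋀-elim : ∀ {r} (φ : Fin r → QF A F N) → Sat S p v (⋀ φ) → ∀ k → Sat S p v (φ k)
  ⋀-elim {suc r} φ (sat₀ , _)    zero    = sat₀
  ⋀-elim {suc r} φ (_ , sat-rest) (suc k) = ⋀-elim (φ ∘ suc) sat-rest k

  ⋀-intro : ∀ {r} (φ : Fin r → QF A F N) → Sat S p v ⊤ᶠ → (∀ k → Sat S p v (φ k)) → Sat S p v (⋀ φ)
  ⋀-intro {zero}  φ sat-⊤ sat = sat-⊤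
  ⋀-intro {suc r} φ sat-⊤ sat = sat zero , ⋀-intro (φ ∘ suc) sat-⊤ (sat ∘ suc)

module Translation (em : ExcludedMiddle 0ℓ) {G : Group 0ℓ 0ℓ} (K : ValuedGField G)
                   (en : Enumeration G) (B : TraceNorm.DualBasis K en) where
  module K = TraceNorm K en
  open K.DualBasis B public
  open Group G using () renaming (Carrier to Elem)

  C : Set
  C = ConstCarrier K

  trace : K.Carrier → C
  trace y = K.Tr y , K.Tr-fixed y

  -- Expanding 1 in the dual basis shows that not every Tr bₖ vanishes.
  nonzero-trace : ∃ λ k₀ → K.Tr (b k₀) ≢ K.0#
  nonzero-trace with em {∃ λ k → K.Tr (b k) ≢ K.0#}
  ... | yes found = found
  ... | no none   = ⊥-elim (K.0≢1 (sym (begin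
    K.1#                                           ≡⟨ expansion K.1# ⟩
    K.sum (λ k → d k K.* K.Tr (b k K.* K.1#))      ≡⟨ K.sum-cong-≗ (λ k → trans (cong (d k K.*_) (trace-zero k)) (K.zeroʳ _)) ⟩
    K.sum {size} (λ _ → K.0#)                      ≡⟨ K.sum-replicate-zero size ⟩
    K.0#                                           ∎)))
    where
      open ≡-Reasoning
      trace-zero : ∀ k → K.Tr (b k K.* K.1#) ≡ K.0#
      trace-zero k with em {K.Tr (b k) ≡ K.0#}
      ... | yes Tr≡0 = trans (cong K.Tr (K.*-identityʳ (b k))) Tr≡0
      ... | no Tr≢0  = ⊥-elim (none (k , Tr≢0))

  k₀ : Fin size
  k₀ = proj₁ nonzero-trace

  ρ : K.Carrier
  ρ = proj₁ (K.inverse _ (proj₂ nonzero-trace))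

  Tr-b₀*ρ≡1 : K.Tr (b k₀) K.* ρ ≡ K.1#
  Tr-b₀*ρ≡1 = proj₂ (K.inverse _ (proj₂ nonzero-trace))

  ρ-fixed : Fixed K ρ
  ρ-fixed g = K.inverse-unique (K.Tr (b k₀)) (K.σ g ρ) ρ σ-inverse Tr-b₀*ρ≡1
    where
      σ-inverse : K.Tr (b k₀) K.* K.σ g ρ ≡ K.1#
      σ-inverse = trans (cong (K._* K.σ g ρ) (sym (K.Tr-fixed (b k₀) g)))
                        (trans (sym (ValuedGField.σ-* K g _ ρ))
                               (trans (cong (K.σ g) Tr-b₀*ρ≡1) (ValuedGField.σ-1 K g)))

  ρᶜ : C
  ρᶜ = ρ , ρ-fixed

  -- Constant terms with ⟦ t ⟧ = Σᵢ dᵢ ⟦ components t i ⟧, the variable x being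
  -- replaced by the constants (combine x i); products and σ_g are re-expanded
  -- through the coordinates of dᵢ dⱼ and σ_g(dᵢ).
  components : ∀ {N} → Term K.Carrier Elem N → Fin size → Term C ⊥ (N ℕ.* size)
  components (var x)   i = var (combine x i)
  components (par c)   i = par (trace (b i K.* c))
  components zer       i = zer
  components one       i = par (trace (b i K.* K.1#))
  components (add s t) i = add (components s i) (components t i)
  components (mul s t) k =
    ∑ₜ λ i → ∑ₜ λ j → mul (par (trace (b k K.* (d i K.* d j)))) (mul (components s i) (components t j))
  components (neg t)   i = neg (components t i)
  components (app g t) k = ∑ₜ λ i → mul (par (trace (b k K.* K.σ g (d i)))) (components t i)

  coordinate : ∀ {N} → Fin size → Term K.Carrier Elem N → Term C ⊥ (N ℕ.* size)
  coordinate k t = ∑ₜ λ i → mul (par (trace (b k K.* d i))) (components t i)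

  normTerm : ∀ {N} → Term K.Carrier Elem N → Term K.Carrier Elem N
  normTerm t = ∏ₜ λ l → app (K.elem l) t

  -- O y ⇔ O (Nm y), and the constant Nm y = Tr (b_k₀ Nm y) · ρ is a coordinate times ρ.
  translate : ∀ {N} → QF K.Carrier Elem N → QF C ⊥ (N ℕ.* size)
  translate (eq s t)  = ⋀ λ k → eq (coordinate k s) (coordinate k t)
  translate (pred t)  = pred (mul (coordinate k₀ (normTerm t)) (par ρᶜ))
  translate (not φ)   = not (translate φ)
  translate (and φ ψ) = and (translate φ) (translate ψ)
  translate (or φ ψ)  = or (translate φ) (translate ψ)

  -- ιᶜ is constEmb E, or the identity of C when L = K (it differs from constEmb (idExtension K)
  -- in the fixedness proofs, which Sat cannot ignore).
  module Semantics (L : ValuedGField G) (E : Extension K L) (ιᶜ : C → ConstCarrier L)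
                   (ιᶜ-ι : ∀ c → proj₁ (ιᶜ c) ≡ Extension.ι E (proj₁ c)) where
    open TraceNorm L en
    open Extension E
    open ValuedGField L using (σ-*)
    open ≡-Reasoning

    ι-sum : ∀ {r} (f : Fin r → K.Carrier) → ι (K.sum f) ≡ sum (λ i → ι (f i))
    ι-sum {zero}  f = ι-0
    ι-sum {suc r} f = trans (ι-+ _ _) (cong (ι (f zero) +_) (ι-sum (f ∘ suc)))

    ι-Tr : ∀ y → ι (K.Tr y) ≡ Tr (ι y)
    ι-Tr y = trans (ι-sum (λ l → K.σ (elem l) y)) (sum-cong-≗ (λ l → ι-σ (elem l) y))

    a : Fin size → Carrier
    a i = ι (d i)

    ι-dual : ∀ g → sum (λ i → a i * σ g (ι (b i))) ≡ ι (K.sum (λ i → d i K.* K.σ g (b i)))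
    ι-dual g = begin
      sum (λ i → a i * σ g (ι (b i)))        ≡⟨ sum-cong-≗ (λ i → trans (cong (a i *_) (sym (ι-σ g (b i)))) (sym (ι-* _ _))) ⟩
      sum (λ i → ι (d i K.* K.σ g (b i)))    ≡⟨ ι-sum (λ i → d i K.* K.σ g (b i)) ⟨
      ι (K.sum (λ i → d i K.* K.σ g (b i)))  ∎

    dualBasisᴸ : DualBasis
    dualBasisᴸ = record
      { size   = size
      ; d      = a
      ; b      = ι ∘ b
      ; dual-ε = λ g g≈ε → trans (ι-dual g) (trans (cong ι (dual-ε g g≈ε)) ι-1)
      ; dual-≉ = λ g g≉ε → trans (ι-dual g) (trans (cong ι (dual-≉ g g≉ε)) ι-0)
      }

    module Bᴸ = DualBasis dualBasisᴸ

    ι-expansion : ∀ x → ι x ≡ sum (λ k → a k * ι (K.Tr (b k K.* x)))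
    ι-expansion x = trans (Bᴸ.expansion (ι x)) (sum-cong-≗ (λ k → cong (a k *_)
      (trans (cong Tr (sym (ι-* (b k) x))) (sym (ι-Tr _)))))

    expand-coefficients : ∀ {r} (c : Fin r → K.Carrier) (X : Fin r → Carrier) →
      sum (λ i → ι (c i) * X i) ≡ sum (λ k → a k * sum (λ i → ι (K.Tr (b k K.* c i)) * X i))
    expand-coefficients c X = begin
      sum (λ i → ι (c i) * X i)
        ≡⟨ sum-cong-≗ (λ i → cong (_* X i) (ι-expansion (c i))) ⟩
      sum (λ i → sum (λ k → a k * ι (K.Tr (b k K.* c i))) * X i)
        ≡⟨ sum-cong-≗ (λ i → trans (*-distribʳ-sum (X i) (λ k → a k * ι (K.Tr (b k K.* c i))))
                                   (sum-cong-≗ (λ k → *-assoc (a k) (ι (K.Tr (b k K.* c i))) (X i)))) ⟩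
      sum (λ i → sum (λ k → a k * (ι (K.Tr (b k K.* c i)) * X i)))
        ≡⟨ ∑-comm-factorˡ a (λ i k → ι (K.Tr (b k K.* c i)) * X i) ⟩
      sum (λ k → a k * sum (λ i → ι (K.Tr (b k K.* c i)) * X i)) ∎

    combination-* : ∀ (X Y : Fin size → Carrier) →
      sum (λ i → a i * X i) * sum (λ j → a j * Y j) ≡
      sum (λ k → a k * sum (λ i → sum (λ j → ι (K.Tr (b k K.* (d i K.* d j))) * (X i * Y j))))
    combination-* X Y = begin
      sum (λ i → a i * X i) * sum (λ j → a j * Y j)
        ≡⟨ trans (*-distribʳ-sum (sum (λ j → a j * Y j)) (λ i → a i * X i)) (sum-cong-≗ (λ i → *-distribˡ-sum (a i * X i) (λ j → a j * Y j))) ⟩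
      sum (λ i → sum (λ j → (a i * X i) * (a j * Y j)))
        ≡⟨ sum-cong-≗ (λ i → sum-cong-≗ (λ j → trans (interchange (a i) (X i) (a j) (Y j))
                                                     (cong (_* (X i * Y j)) (sym (ι-* (d i) (d j)))))) ⟩
      sum (λ i → sum (λ j → ι (d i K.* d j) * (X i * Y j)))
        ≡⟨ sum-cong-≗ (λ i → expand-coefficients (λ j → d i K.* d j) (λ j → X i * Y j)) ⟩
      sum (λ i → sum (λ k → a k * sum (λ j → ι (K.Tr (b k K.* (d i K.* d j))) * (X i * Y j))))
        ≡⟨ ∑-comm-factorˡ a (λ i k → sum (λ j → ι (K.Tr (b k K.* (d i K.* d j))) * (X i * Y j))) ⟩
      sum (λ k → a k * sum (λ i → sum (λ j → ι (K.Tr (b k K.* (d i K.* d j))) * (X i * Y j)))) ∎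
      where
        interchange : ∀ x y z u → (x * y) * (z * u) ≡ (x * z) * (y * u)
        interchange = solve 4 (λ x y z u → (x :* y) :* (z :* u) := (x :* z) :* (y :* u)) refl

    σ-combination : ∀ g (X : Fin size → Carrier) → (∀ i → Fixed L (X i)) →
      σ g (sum (λ i → a i * X i)) ≡ sum (λ k → a k * sum (λ i → ι (K.Tr (b k K.* K.σ g (d i))) * X i))
    σ-combination g X X-fixed = begin
      σ g (sum (λ i → a i * X i))        ≡⟨ σ-sum g (λ i → a i * X i) ⟩
      sum (λ i → σ g (a i * X i))        ≡⟨ sum-cong-≗ (λ i → trans (σ-* g _ _) (cong₂ _*_ (sym (ι-σ g (d i))) (X-fixed i g))) ⟩
      sum (λ i → ι (K.σ g (d i)) * X i)  ≡⟨ expand-coefficients (λ i → K.σ g (d i)) X ⟩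
      sum (λ k → a k * sum (λ i → ι (K.Tr (b k K.* K.σ g (d i))) * X i)) ∎

    evalᴳ : ∀ {N} → (Fin N → Carrier) → Term K.Carrier Elem N → Carrier
    evalᴳ v t = eval (GStructure L) ι v t

    evalᶜ : ∀ {N} → (Fin N → ConstCarrier L) → Term C ⊥ N → Carrier
    evalᶜ w t = proj₁ (eval (ConstStructure L) ιᶜ w t)

    evalᶜ-fixed : ∀ {N} (w : Fin N → ConstCarrier L) t → Fixed L (evalᶜ w t)
    evalᶜ-fixed w t = proj₂ (eval (ConstStructure L) ιᶜ w t)

    evalᶜ-∑ₜ : ∀ {N r} (w : Fin N → ConstCarrier L) (f : Fin r → Term C ⊥ N) →
      evalᶜ w (∑ₜ f) ≡ sum (λ i → evalᶜ w (f i))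
    evalᶜ-∑ₜ {r = zero}  w f = refl
    evalᶜ-∑ₜ {r = suc r} w f = cong (evalᶜ w (f zero) +_) (evalᶜ-∑ₜ w (f ∘ suc))

    evalᴳ-∏ₜ : ∀ {N r} (v : Fin N → Carrier) (f : Fin r → Term K.Carrier Elem N) →
      evalᴳ v (∏ₜ f) ≡ prod (λ i → evalᴳ v (f i))
    evalᴳ-∏ₜ {r = zero}  v f = refl
    evalᴳ-∏ₜ {r = suc r} v f = cong (evalᴳ v (f zero) *_) (evalᴳ-∏ₜ v (f ∘ suc))

    module _ {N} (v : Fin N → Carrier) (w : Fin (N ℕ.* size) → ConstCarrier L)
             (v≡ : ∀ x → v x ≡ sum (λ i → a i * proj₁ (w (combine x i)))) where

      val : Term K.Carrier Elem N → Fin size → Carrier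
      val t i = evalᶜ w (components t i)

      ι≡components-par : ∀ c → ι c ≡ sum (λ i → a i * val (par c) i)
      ι≡components-par c = trans (ι-expansion c) (sum-cong-≗ (λ i → cong (a i *_) (sym (ιᶜ-ι (trace _)))))

      val-mul : ∀ s t k →
        val (mul s t) k ≡ sum (λ i → sum (λ j → ι (K.Tr (b k K.* (d i K.* d j))) * (val s i * val t j)))
      val-mul s t k = trans (evalᶜ-∑ₜ w (λ i → ∑ₜ λ j → term i j)) (sum-cong-≗ (λ i → trans (evalᶜ-∑ₜ w (term i))
                      (sum-cong-≗ (λ j → cong (_* (val s i * val t j)) (ιᶜ-ι (trace (b k K.* (d i K.* d j))))))))
        where
          term : Fin size → Fin size → Term C ⊥ (N ℕ.* size)
          term i j = mul (par (trace (b k K.* (d i K.* d j)))) (mul (components s i) (components t j))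

      val-app : ∀ g t k → val (app g t) k ≡ sum (λ i → ι (K.Tr (b k K.* K.σ g (d i))) * val t i)
      val-app g t k = trans (evalᶜ-∑ₜ w (λ i → mul (par (trace (b k K.* K.σ g (d i)))) (components t i)))
                          (sum-cong-≗ (λ i → cong (_* val t i) (ιᶜ-ι (trace (b k K.* K.σ g (d i))))))

      evalᴳ-components : ∀ t → evalᴳ v t ≡ sum (λ i → a i * val t i)
      evalᴳ-components (var x) = v≡ x
      evalᴳ-components (par c) = ι≡components-par c
      evalᴳ-components zer = sym (trans (sum-cong-≗ (λ i → zeroʳ (a i))) (sum-replicate-zero size))
      evalᴳ-components one = trans (sym ι-1) (ι≡components-par K.1#)
      evalᴳ-components (add s t) = begin
        evalᴳ v s + evalᴳ v t                               ≡⟨ cong₂ _+_ (evalᴳ-components s) (evalᴳ-components t) ⟩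
        sum (λ i → a i * val s i) + sum (λ i → a i * val t i)   ≡⟨ ∑-distrib-+ (λ i → a i * val s i) (λ i → a i * val t i) ⟨
        sum (λ i → a i * val s i + a i * val t i)               ≡⟨ sum-cong-≗ (λ i → distribˡ (a i) (val s i) (val t i)) ⟨
        sum (λ i → a i * (val s i + val t i))                   ∎
      evalᴳ-components (neg t) = begin
        - evalᴳ v t                  ≡⟨ cong -_ (evalᴳ-components t) ⟩
        - sum (λ i → a i * val t i)    ≡⟨ -‿distrib-sum (λ i → a i * val t i) ⟩
        sum (λ i → - (a i * val t i))  ≡⟨ sum-cong-≗ (λ i → -‿distribʳ-* (a i) (val t i)) ⟩
        sum (λ i → a i * - val t i)    ∎
      evalᴳ-components (mul s t) = begin
        evalᴳ v s * evalᴳ v t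
          ≡⟨ cong₂ _*_ (evalᴳ-components s) (evalᴳ-components t) ⟩
        sum (λ i → a i * val s i) * sum (λ j → a j * val t j)
          ≡⟨ combination-* (val s) (val t) ⟩
        sum (λ k → a k * sum (λ i → sum (λ j → ι (K.Tr (b k K.* (d i K.* d j))) * (val s i * val t j))))
          ≡⟨ sum-cong-≗ (λ k → cong (a k *_) (sym (val-mul s t k))) ⟩
        sum (λ k → a k * val (mul s t) k) ∎

      evalᴳ-components (app g t) = begin
        σ g (evalᴳ v t)
          ≡⟨ cong (σ g) (evalᴳ-components t) ⟩
        σ g (sum (λ i → a i * val t i))
          ≡⟨ σ-combination g (val t) (λ i → evalᶜ-fixed w (components t i)) ⟩
        sum (λ k → a k * sum (λ i → ι (K.Tr (b k K.* K.σ g (d i))) * val t i))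
          ≡⟨ sum-cong-≗ (λ k → cong (a k *_) (sym (val-app g t k))) ⟩
        sum (λ k → a k * val (app g t) k) ∎

      evalᶜ-coordinate : ∀ k s → evalᶜ w (coordinate k s) ≡ Tr (ι (b k) * evalᴳ v s)
      evalᶜ-coordinate k s = begin
        evalᶜ w (coordinate k s)
          ≡⟨ evalᶜ-∑ₜ w (λ i → mul (par (trace (b k K.* d i))) (components s i)) ⟩
        sum (λ i → proj₁ (ιᶜ (trace (b k K.* d i))) * val s i)
          ≡⟨ sum-cong-≗ (λ i → cong (_* val s i) (trans (ιᶜ-ι _) (trans (ι-Tr _) (cong Tr (ι-* (b k) (d i)))))) ⟩
        sum (λ i → Tr (ι (b k) * a i) * val s i)
          ≡⟨ Bᴸ.Tr-*-combination k (val s) (λ i → evalᶜ-fixed w (components s i)) ⟨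
        Tr (ι (b k) * sum (λ i → a i * val s i))
          ≡⟨ cong (λ y → Tr (ι (b k) * y)) (evalᴳ-components s) ⟨
        Tr (ι (b k) * evalᴳ v s) ∎

      evalᶜ-norm : ∀ t → evalᶜ w (mul (coordinate k₀ (normTerm t)) (par ρᶜ)) ≡ Nm (evalᴳ v t)
      evalᶜ-norm t = begin
        evalᶜ w (coordinate k₀ (normTerm t)) * proj₁ (ιᶜ ρᶜ)
          ≡⟨ cong₂ _*_ (evalᶜ-coordinate k₀ (normTerm t)) (ιᶜ-ι ρᶜ) ⟩
        Tr (ι (b k₀) * evalᴳ v (normTerm t)) * ι ρ
          ≡⟨ cong (λ z → Tr (ι (b k₀) * z) * ι ρ) (evalᴳ-∏ₜ v (λ l → app (elem l) t)) ⟩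
        Tr (ι (b k₀) * Nm y) * ι ρ
          ≡⟨ cong (λ z → Tr z * ι ρ) (*-comm (ι (b k₀)) (Nm y)) ⟩
        Tr (Nm y * ι (b k₀)) * ι ρ
          ≡⟨ cong (_* ι ρ) (Tr-*ˡ-fixed (Nm y) (Nm-fixed y) (ι (b k₀))) ⟩
        Nm y * Tr (ι (b k₀)) * ι ρ
          ≡⟨ cong (λ z → Nm y * z * ι ρ) (ι-Tr (b k₀)) ⟨
        Nm y * ι (K.Tr (b k₀)) * ι ρ
          ≡⟨ *-assoc (Nm y) _ _ ⟩
        Nm y * (ι (K.Tr (b k₀)) * ι ρ)
          ≡⟨ cong (Nm y *_) (trans (sym (ι-* _ _)) (trans (cong ι Tr-b₀*ρ≡1) ι-1)) ⟩
        Nm y * 1#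
          ≡⟨ *-identityʳ (Nm y) ⟩
        Nm y ∎
        where
          y : Carrier
          y = evalᴳ v t

      sat⇒sat-translate : ∀ φ → Sat (GStructure L) ι v φ → Sat (ConstStructure L) ιᶜ w (translate φ)
      sat-translate⇒sat : ∀ φ → Sat (ConstStructure L) ιᶜ w (translate φ) → Sat (GStructure L) ι v φ

      sat⇒sat-translate (eq s t) s≡t = ⋀-intro (ConstStructure L) ιᶜ w _ refl (λ k →
        trans (evalᶜ-coordinate k s) (trans (cong (λ y → Tr (ι (b k) * y)) s≡t) (sym (evalᶜ-coordinate k t))))
      sat⇒sat-translate (pred t) Ot = subst O (sym (evalᶜ-norm t)) (O⇒O-Nm _ Ot)
      sat⇒sat-translate (not φ) ¬φ = ¬φ ∘ sat-translate⇒sat φ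
      sat⇒sat-translate (and φ ψ) (φ-holds , ψ-holds) = sat⇒sat-translate φ φ-holds , sat⇒sat-translate ψ ψ-holds
      sat⇒sat-translate (or φ ψ) (inj₁ φ-holds) = inj₁ (sat⇒sat-translate φ φ-holds)
      sat⇒sat-translate (or φ ψ) (inj₂ ψ-holds) = inj₂ (sat⇒sat-translate ψ ψ-holds)

      sat-translate⇒sat (eq s t) coordinates≡ = Bᴸ.Tr-coordinates-injective (evalᴳ v s) (evalᴳ v t) (λ k →
        trans (sym (evalᶜ-coordinate k s))
              (trans (⋀-elim (ConstStructure L) ιᶜ w _ coordinates≡ k) (evalᶜ-coordinate k t)))
      sat-translate⇒sat (pred t) O-norm = O-Nm⇒O em _ (subst O (evalᶜ-norm t) O-norm)
      sat-translate⇒sat (not φ) ¬φ = ¬φ ∘ sat⇒sat-translate φ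
      sat-translate⇒sat (and φ ψ) (φ-holds , ψ-holds) = sat-translate⇒sat φ φ-holds , sat-translate⇒sat ψ ψ-holds
      sat-translate⇒sat (or φ ψ) (inj₁ φ-holds) = inj₁ (sat-translate⇒sat φ φ-holds)
      sat-translate⇒sat (or φ ψ) (inj₂ ψ-holds) = inj₂ (sat-translate⇒sat ψ ψ-holds)

idExtension : ∀ {G} (K : ValuedGField G) → Extension K K
idExtension K = record
  { ι = λ x → x ; ι-0 = refl ; ι-1 = refl ; ι-+ = λ _ _ → refl ; ι-- = λ _ → refl
  ; ι-* = λ _ _ → refl ; ι-σ = λ _ _ → refl ; ι-O = λ _ Ox → Ox ; ι-O⁻ = λ _ Ox → Ox }

module ConstantFormulas {G : Group 0ℓ 0ℓ} (K : ValuedGField G) where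
  open Group G using () renaming (Carrier to Elem)
  open ValuedGField K using (Carrier)

  liftTerm : ∀ {N} → Term (ConstCarrier K) ⊥ N → Term Carrier Elem N
  liftTerm (var x)   = var x
  liftTerm (par c)   = par (proj₁ c)
  liftTerm zer       = zer
  liftTerm one       = one
  liftTerm (add s t) = add (liftTerm s) (liftTerm t)
  liftTerm (mul s t) = mul (liftTerm s) (liftTerm t)
  liftTerm (neg t)   = neg (liftTerm t)

  liftFormula : ∀ {N} → QF (ConstCarrier K) ⊥ N → QF Carrier Elem N
  liftFormula (eq s t)  = eq (liftTerm s) (liftTerm t)
  liftFormula (pred t)  = pred (liftTerm t)
  liftFormula (not φ)   = not (liftFormula φ)
  liftFormula (and φ ψ) = and (liftFormula φ) (liftFormula ψ)
  liftFormula (or φ ψ)  = or (liftFormula φ) (liftFormula ψ)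

  fixedVariables : ∀ {N r} → (Fin r → Elem) → QF Carrier Elem N
  fixedVariables f = ⋀ λ x → ⋀ λ i → eq (app (f i) (var x)) (var x)

  module Semantics {L : ValuedGField G} (E : Extension K L) {N} (v : Fin N → ValuedGField.Carrier L) where
    open Extension E
    open ValuedGField L using (_+_; _*_; -_; O; σ)

    fixedVariables-intro : ∀ {r} (f : Fin r → Elem) → (∀ x → Fixed L (v x)) →
      Sat (GStructure L) ι v (fixedVariables f)
    fixedVariables-intro f v-fixed = ⋀-intro (GStructure L) ι v _ refl (λ x →
      ⋀-intro (GStructure L) ι v _ refl (λ i → v-fixed x (f i)))

    fixedVariables-elim : ∀ {r} (f : Fin r → Elem) → Sat (GStructure L) ι v (fixedVariables f) →
      ∀ x i → σ (f i) (v x) ≡ v x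
    fixedVariables-elim f sat x = ⋀-elim (GStructure L) ι v _ (⋀-elim (GStructure L) ι v _ sat x)

    module _ (ιᶜ : ConstCarrier K → ConstCarrier L) (ιᶜ-ι : ∀ c → proj₁ (ιᶜ c) ≡ ι (proj₁ c))
             (w : Fin N → ConstCarrier L) (v≡w : ∀ x → v x ≡ proj₁ (w x)) where

      eval-liftTerm : ∀ t → eval (GStructure L) ι v (liftTerm t) ≡ proj₁ (eval (ConstStructure L) ιᶜ w t)
      eval-liftTerm (var x)   = v≡w x
      eval-liftTerm (par c)   = sym (ιᶜ-ι c)
      eval-liftTerm zer       = refl
      eval-liftTerm one       = refl
      eval-liftTerm (add s t) = cong₂ _+_ (eval-liftTerm s) (eval-liftTerm t)
      eval-liftTerm (mul s t) = cong₂ _*_ (eval-liftTerm s) (eval-liftTerm t)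
      eval-liftTerm (neg t)   = cong -_ (eval-liftTerm t)

      sat-lift⇒sat : ∀ φ → Sat (GStructure L) ι v (liftFormula φ) → Sat (ConstStructure L) ιᶜ w φ
      sat⇒sat-lift : ∀ φ → Sat (ConstStructure L) ιᶜ w φ → Sat (GStructure L) ι v (liftFormula φ)

      sat-lift⇒sat (eq s t) s≡t = trans (sym (eval-liftTerm s)) (trans s≡t (eval-liftTerm t))
      sat-lift⇒sat (pred t) Ot = subst O (eval-liftTerm t) Ot
      sat-lift⇒sat (not φ) ¬φ = ¬φ ∘ sat⇒sat-lift φ
      sat-lift⇒sat (and φ ψ) (φ-holds , ψ-holds) = sat-lift⇒sat φ φ-holds , sat-lift⇒sat ψ ψ-holds
      sat-lift⇒sat (or φ ψ) (inj₁ φ-holds) = inj₁ (sat-lift⇒sat φ φ-holds)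
      sat-lift⇒sat (or φ ψ) (inj₂ ψ-holds) = inj₂ (sat-lift⇒sat ψ ψ-holds)

      sat⇒sat-lift (eq s t) s≡t = trans (eval-liftTerm s) (trans s≡t (sym (eval-liftTerm t)))
      sat⇒sat-lift (pred t) Ot = subst O (sym (eval-liftTerm t)) Ot
      sat⇒sat-lift (not φ) ¬φ = ¬φ ∘ sat-lift⇒sat φ
      sat⇒sat-lift (and φ ψ) (φ-holds , ψ-holds) = sat⇒sat-lift φ φ-holds , sat⇒sat-lift ψ ψ-holds
      sat⇒sat-lift (or φ ψ) (inj₁ φ-holds) = inj₁ (sat⇒sat-lift φ φ-holds)
      sat⇒sat-lift (or φ ψ) (inj₂ ψ-holds) = inj₂ (sat⇒sat-lift ψ ψ-holds)

-- A constant solution in K′ of ψ is a solution of ψ ∧ "every variable is fixed by each listed g".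
constants-existentiallyClosed : ∀ {G} → FiniteGroup G → (K K′ : ValuedGField G) (E : Extension K K′) →
  ExistentiallyClosed (GStructure K) (GStructure K′) (Extension.ι E) →
  ExistentiallyClosed (ConstStructure K) (ConstStructure K′) (constEmb E)
constants-existentiallyClosed {G} (_ , f , f-surjective) K K′ E closed N ψ (w′ , ψ-holds′) = w , ψ-holds
  where
    open ConstantFormulas K
    v′ : Fin N → ValuedGField.Carrier K′
    v′ x = proj₁ (w′ x)
    module Sem′ = Semantics E v′
    solution : Σ (Fin N → ValuedGField.Carrier K) λ v →
      Sat (GStructure K) (λ a → a) v (and (liftFormula ψ) (fixedVariables f))
    solution = closed N (and (liftFormula ψ) (fixedVariables f))
      (v′ , Sem′.sat⇒sat-lift (constEmb E) (λ _ → refl) w′ (λ _ → refl) ψ ψ-holds′ ,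
            Sem′.fixedVariables-intro f (λ x → proj₂ (w′ x)))
    v : Fin N → ValuedGField.Carrier K
    v = proj₁ solution
    module Sem = Semantics (idExtension K) v
    w : Fin N → ConstCarrier K
    w x = v x , λ g → trans (ValuedGField.σ-cong K (v x) (Group.sym G (proj₂ (f-surjective g))))
                            (Sem.fixedVariables-elim f (proj₂ (proj₂ solution)) x (proj₁ (f-surjective g)))
    ψ-holds : Sat (ConstStructure K) (λ c → c) w ψ
    ψ-holds = Sem.sat-lift⇒sat (λ c → c) (λ _ → refl) w (λ _ → refl) ψ (proj₁ (proj₂ solution))

existentiallyClosed-from-constants : ExcludedMiddle 0ℓ → ∀ {G} → FiniteGroup G →
  (K K′ : ValuedGField G) → Strict K → (E : Extension K K′) →
  ExistentiallyClosed (ConstStructure K) (ConstStructure K′) (constEmb E) →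
  ExistentiallyClosed (GStructure K) (GStructure K′) (Extension.ι E)
existentiallyClosed-from-constants em {G} finite K K′ strict E closed N φ (v′ , φ-holds′) =
  v , Semᴷ.sat-translate⇒sat v w (λ _ → refl) φ (proj₂ solution)
  where
    en : Enumeration G
    en = enumerate em G finite
    open Translation em K en (DualBasisConstruction.dualBasis em K strict en)
    module K′ = TraceNorm K′ en
    module Sem′ = Semantics K′ E (constEmb E) (λ _ → refl)
    module Semᴷ = Semantics K (idExtension K) (λ c → c) (λ _ → refl)
    coordinates′ : Fin N × Fin size → ConstCarrier K′
    coordinates′ (x , i) = K′.Tr (Extension.ι E (b i) K′.* v′ x) , K′.Tr-fixed _
    w′ : Fin (N ℕ.* size) → ConstCarrier K′
    w′ = coordinates′ ∘ remQuot size
    v′≡ : ∀ x → v′ x ≡ K′.sum (λ i → Sem′.a i K′.* proj₁ (w′ (combine x i)))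
    v′≡ x = trans (Sem′.Bᴸ.expansion (v′ x)) (K′.sum-cong-≗ (λ i →
      cong (λ p → Sem′.a i K′.* proj₁ (coordinates′ p)) (sym (remQuot-combine x i))))
    solution : Σ (Fin (N ℕ.* size) → ConstCarrier K) λ w → Sat (ConstStructure K) (λ c → c) w (translate φ)
    solution = closed (N ℕ.* size) (translate φ) (w′ , Sem′.sat⇒sat-translate v′ w′ v′≡ φ φ-holds′)
    w : Fin (N ℕ.* size) → ConstCarrier K
    w = proj₁ solution
    v : Fin N → ValuedGField.Carrier K
    v x = K.sum (λ i → d i K.* proj₁ (w (combine x i)))

lemma3p8 : ExcludedMiddle 0ℓ →
    (G : Group 0ℓ 0ℓ) → FiniteGroup G →
    (K K' : ValuedGField G) → Strict K → Strict K' →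
    (E : Extension K K') →
    ExistentiallyClosed (GStructure K) (GStructure K') (Extension.ι E)
      ⇔ ExistentiallyClosed (ConstStructure K) (ConstStructure K') (constEmb E)
lemma3p8 em G finite K K' strict _ E =
  mk⇔ (constants-existentiallyClosed finite K K' E)
      (existentiallyClosed-from-constants em finite K K' strict E)
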